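{- Let $S$ be a $t$-conorm, $N$ a fuzzy negation and $T$ a $t$-norm. Then the function $I_{S,N,T}:[0,1]^2\to[0,1]$, $I_{S,N,T}(x,y)=S(N(T(x,N(y))),N(x))$, is a fuzzy implication.
   Context: A $t$-norm is a function $T:[0,1]^2\to[0,1]$ that is commutative, associative, non-decreasing in each argument and satisfies $T(x,1)=x$ for all $x$. A $t$-conorm is a function $S:[0,1]^2\to[0,1]$ that is commutative, associative, non-decreasing in each argument and satisfies $S(x,0)=x$ for all $x$. A fuzzy negation is a non-increasing function $N:[0,1]\to[0,1]$ with $N(0)=1$ and $N(1)=0$. A fuzzy implication is a function $I:[0,1]^2\to[0,1]$ that is non-increasing in its first argument, non-decreasing in its second argument, and satisfies $I(0,0)=1$, $I(1,1)=1$, $I(1,0)=0$. -}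

module Defs where

open import Data.Nat using (ℕ)
open import Data.Product using (Σ; ∃; _×_; _,_)
open import Relation.Binary.PropositionalEquality using (_≡_; _≢_)
open import Relation.Binary.Structures using (IsTotalOrder)

-- An axiomatic model of the real unit interval [0,1]: a Dedekind-complete,
-- dense, separable linear order with distinct endpoints.  (Classically every
-- such structure is order-isomorphic to the real interval [0,1].)
record UnitInterval : Set₁ where
  field
    Carrier      : Set
    _≤_          : Carrier → Carrier → Set
    isTotalOrder : IsTotalOrder _≡_ _≤_
    𝟎 𝟏          : Carrier
    𝟎-min        : ∀ x → 𝟎 ≤ x
    𝟏-max        : ∀ x → x ≤ 𝟏
    𝟎≢𝟏          : 𝟎 ≢ 𝟏

  _<_ : Carrier → Carrier → Set
  x < y = x ≤ y × x ≢ y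

  field
    dense     : ∀ x y → x < y → ∃ λ z → x < z × z < y
    complete  : (P : Carrier → Set) →
                ∃ λ s → (∀ x → P x → x ≤ s) × (∀ u → (∀ x → P x → x ≤ u) → s ≤ u)
    separable : ∃ λ (d : ℕ → Carrier) → ∀ x y → x < y → ∃ λ n → x < d n × d n < y

module _ (U : UnitInterval) where
  open UnitInterval U

  record IsTNorm (T : Carrier → Carrier → Carrier) : Set where
    field
      comm  : ∀ x y → T x y ≡ T y x
      assoc : ∀ x y z → T x (T y z) ≡ T (T x y) z
      mono  : ∀ x x′ y y′ → x ≤ x′ → y ≤ y′ → T x y ≤ T x′ y′
      identʳ : ∀ x → T x 𝟏 ≡ x

  record IsTConorm (S : Carrier → Carrier → Carrier) : Set where
    field
      comm  : ∀ x y → S x y ≡ S y x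
      assoc : ∀ x y z → S x (S y z) ≡ S (S x y) z
      mono  : ∀ x x′ y y′ → x ≤ x′ → y ≤ y′ → S x y ≤ S x′ y′
      identʳ : ∀ x → S x 𝟎 ≡ x

  record IsFuzzyNegation (N : Carrier → Carrier) : Set where
    field
      antitone : ∀ x y → x ≤ y → N y ≤ N x
      N𝟎       : N 𝟎 ≡ 𝟏
      N𝟏       : N 𝟏 ≡ 𝟎

  record IsFuzzyImplication (I : Carrier → Carrier → Carrier) : Set where
    field
      antitone₁ : ∀ x x′ y → x ≤ x′ → I x′ y ≤ I x y
      monotone₂ : ∀ x y y′ → y ≤ y′ → I x y ≤ I x y′
      I𝟎𝟎       : I 𝟎 𝟎 ≡ 𝟏
      I𝟏𝟏       : I 𝟏 𝟏 ≡ 𝟏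
      I𝟏𝟎       : I 𝟏 𝟎 ≡ 𝟎

  I[_,_,_] : (Carrier → Carrier → Carrier) → (Carrier → Carrier) →
             (Carrier → Carrier → Carrier) → Carrier → Carrier → Carrier
  I[ S , N , T ] x y = S (N (T x (N y))) (N x)

{-# OPTIONS --safe #-}
module Submission where

open import Defs
open UnitInterval
open import Relation.Binary.PropositionalEquality using (_≡_; cong; subst; module ≡-Reasoning)
open import Relation.Binary.Structures using (IsTotalOrder)

module _ (U : UnitInterval) where
  open UnitInterval U using () renaming (_≤_ to _≤ᵤ_)
  open IsTotalOrder (isTotalOrder U) using (antisym) renaming (refl to ≤-refl)

  module _ {T : Carrier U → Carrier U → Carrier U} (isT : IsTNorm U T) where
    open IsTNorm isT

    T-identityˡ : ∀ y → T (𝟏 U) y ≡ y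
    T-identityˡ y = begin
      T (𝟏 U) y  ≡⟨ comm (𝟏 U) y ⟩
      T y (𝟏 U)  ≡⟨ identʳ y ⟩
      y          ∎
      where open ≡-Reasoning

  module _ {S : Carrier U → Carrier U → Carrier U} (isS : IsTConorm U S) where
    open IsTConorm isS

    S-zeroʳ : ∀ x → S x (𝟏 U) ≡ 𝟏 U
    S-zeroʳ x = antisym (𝟏-max U _) 𝟏≤S[x,𝟏]
      where
      S[𝟎,𝟏]≡𝟏 : S (𝟎 U) (𝟏 U) ≡ 𝟏 U
      S[𝟎,𝟏]≡𝟏 = subst (S (𝟎 U) (𝟏 U) ≡_) (identʳ (𝟏 U)) (comm (𝟎 U) (𝟏 U))

      𝟏≤S[x,𝟏] : 𝟏 U ≤ᵤ S x (𝟏 U)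
      𝟏≤S[x,𝟏] = subst (_≤ᵤ S x (𝟏 U)) S[𝟎,𝟏]≡𝟏 (mono _ _ _ _ (𝟎-min U x) ≤-refl)

  module _ {S : Carrier U → Carrier U → Carrier U} (isS : IsTConorm U S)
           {N : Carrier U → Carrier U} (isN : IsFuzzyNegation U N)
           {T : Carrier U → Carrier U → Carrier U} (isT : IsTNorm U T) where
    open IsFuzzyNegation isN
    private
      module S = IsTConorm isS
      module T = IsTNorm isT
      I = I[_,_,_] U S N T

    I-antitone₁ : ∀ x x′ y → x ≤ᵤ x′ → I x′ y ≤ᵤ I x y
    I-antitone₁ x x′ y x≤x′ = S.mono _ _ _ _
      (antitone _ _ (T.mono _ _ _ _ x≤x′ ≤-refl))
      (antitone _ _ x≤x′)

    I-monotone₂ : ∀ x y y′ → y ≤ᵤ y′ → I x y ≤ᵤ I x y′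
    I-monotone₂ x y y′ y≤y′ = S.mono _ _ _ _
      (antitone _ _ (T.mono _ _ _ _ ≤-refl (antitone _ _ y≤y′)))
      ≤-refl

    I-𝟎𝟎 : I (𝟎 U) (𝟎 U) ≡ 𝟏 U
    I-𝟎𝟎 = begin
      S (N (T (𝟎 U) (N (𝟎 U)))) (N (𝟎 U))  ≡⟨ cong (S _) N𝟎 ⟩
      S (N (T (𝟎 U) (N (𝟎 U)))) (𝟏 U)      ≡⟨ S-zeroʳ isS _ ⟩
      𝟏 U                                   ∎
      where open ≡-Reasoning

    I-𝟏ʸ : ∀ y → I (𝟏 U) y ≡ N (N y)
    I-𝟏ʸ y = begin
      S (N (T (𝟏 U) (N y))) (N (𝟏 U))  ≡⟨ cong (S _) N𝟏 ⟩
      S (N (T (𝟏 U) (N y))) (𝟎 U)      ≡⟨ S.identʳ _ ⟩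
      N (T (𝟏 U) (N y))                ≡⟨ cong N (T-identityˡ isT (N y)) ⟩
      N (N y)                          ∎
      where open ≡-Reasoning

    I-𝟏𝟏 : I (𝟏 U) (𝟏 U) ≡ 𝟏 U
    I-𝟏𝟏 = begin
      I (𝟏 U) (𝟏 U)  ≡⟨ I-𝟏ʸ (𝟏 U) ⟩
      N (N (𝟏 U))    ≡⟨ cong N N𝟏 ⟩
      N (𝟎 U)        ≡⟨ N𝟎 ⟩
      𝟏 U            ∎
      where open ≡-Reasoning

    I-𝟏𝟎 : I (𝟏 U) (𝟎 U) ≡ 𝟎 U
    I-𝟏𝟎 = begin
      I (𝟏 U) (𝟎 U)  ≡⟨ I-𝟏ʸ (𝟎 U) ⟩
      N (N (𝟎 U))    ≡⟨ cong N N𝟎 ⟩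
      N (𝟏 U)        ≡⟨ N𝟏 ⟩
      𝟎 U            ∎
      where open ≡-Reasoning

proposition3p1 : (U : UnitInterval) →
    (S : Carrier U → Carrier U → Carrier U) → IsTConorm U S →
    (N : Carrier U → Carrier U) → IsFuzzyNegation U N →
    (T : Carrier U → Carrier U → Carrier U) → IsTNorm U T →
    IsFuzzyImplication U (I[_,_,_] U S N T)
proposition3p1 U S isS N isN T isT = record
  { antitone₁ = I-antitone₁ U isS isN isT
  ; monotone₂ = I-monotone₂ U isS isN isT
  ; I𝟎𝟎       = I-𝟎𝟎 U isS isN isT
  ; I𝟏𝟏       = I-𝟏𝟏 U isS isN isT
  ; I𝟏𝟎       = I-𝟏𝟎 U isS isN isT
  }
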